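{- For all integers $n\ge0$, the total number of inversions over all derangements of $[n]$ is $$t_n^{(1)}=\frac{n!}{12}\sum_{k=0}^{n-1}(-1)^k\frac{(3n+k)(n-k-1)}{k!}.$$
   Context: A derangement of $[n]$ is a permutation $\pi$ of $[n]=\{1,\dots,n\}$ with $\pi_i\ne i$ for all $i$. For a permutation $\pi$, $\mathrm{inv}(\pi)=|\{(i,j):i<j,\ \pi_i>\pi_j\}|$. $t_n^{(1)}=\sum_{\pi}\mathrm{inv}(\pi)$, the sum over all derangements $\pi$ of $[n]$. -}

module Defs where

open import Data.Nat using (ℕ; zero; suc; _+_; _*_; _∸_; _!; _<_)
open import Data.Nat.Properties using (_!≢0)
open import Data.Fin using (Fin) renaming (_<_ to _<ᶠ_; _>_ to _>ᶠ_)
open import Data.Fin.Properties using () renaming (_<?_ to _<ᶠ?_)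
open import Data.Fin.Permutation using (Permutation′; _⟨$⟩ʳ_)
open import Data.Nat.ListAction using (sum)
open import Data.List using (List; []; _∷_; map; length; filter; allFin; concatMap; upTo)
open import Data.List.Relation.Unary.All using (All)
open import Data.List.Relation.Unary.Any using (Any)
open import Data.List.Relation.Unary.AllPairs using (AllPairs)
open import Data.Product using (_×_; _,_)
open import Relation.Binary.PropositionalEquality using (_≡_; _≢_)
open import Relation.Nullary using (¬_; Dec)
open import Relation.Nullary.Decidable using (_×-dec_)
open import Data.Integer as ℤ using (ℤ; +_)
open import Data.Rational as ℚ using (ℚ)

Derangement : {n : ℕ} → Permutation′ n → Set
Derangement {n} π = (i : Fin n) → π ⟨$⟩ʳ i ≢ i

SamePerm : {n : ℕ} → Permutation′ n → Permutation′ n → Set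
SamePerm {n} π σ = (i : Fin n) → π ⟨$⟩ʳ i ≡ σ ⟨$⟩ʳ i

inv : {n : ℕ} → Permutation′ n → ℕ
inv {n} π = length (filter (λ p → pred p) pairs)
  where
  pairs : List (Fin n × Fin n)
  pairs = concatMap (λ i → map (λ j → (i , j)) (allFin n)) (allFin n)
  pred : (p : Fin n × Fin n) → Dec (let (i , j) = p in (i <ᶠ j) × (π ⟨$⟩ʳ j <ᶠ π ⟨$⟩ʳ i))
  pred (i , j) = (i <ᶠ? j) ×-dec ((π ⟨$⟩ʳ j) <ᶠ? (π ⟨$⟩ʳ i))

record EnumeratesDerangements (n : ℕ) (ds : List (Permutation′ n)) : Set where
  field
    sound    : All Derangement ds
    complete : (σ : Permutation′ n) → Derangement σ → Any (λ π → SamePerm π σ) ds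
    distinct : AllPairs (λ π σ → ¬ SamePerm π σ) ds

totalInv : {n : ℕ} → List (Permutation′ n) → ℕ
totalInv ds = sum (map inv ds)

sumℚ : List ℚ → ℚ
sumℚ [] = ℚ.0ℚ
sumℚ (x ∷ xs) = x ℚ.+ sumℚ xs

sgn : ℕ → ℤ
sgn zero = ℤ.1ℤ
sgn (suc k) = ℤ.- sgn k

term : ℕ → ℕ → ℚ
term n k = (sgn k ℤ.* (+ (3 * n + k)) ℤ.* (+ n ℤ.- + k ℤ.- ℤ.1ℤ)) ℚ./ (k !)
  where instance _ = k !≢0

rhs : ℕ → ℚ
rhs n = ((+ (n !)) ℚ./ 12) ℚ.* sumℚ (map (term n) (upTo n))

-- Every derangement of {0, …, n+1} arises exactly once either from a derangement σ of n+1
-- points by inserting the new point 0 into a cycle of σ right after some x, or from a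
-- derangement τ of n points by adding a 2-cycle (0 x); hence d(n+2) = (n+1)(d(n+1) + d(n)).
-- Inserting 0 after x creates σ(x) + x + 1 inversions on top of those of σ with x deleted, and
-- an inversion of σ survives deleting any position other than its own two; summing over x
-- gives t(n+2) + 2 t(n+1) = (n+1)(d(n+2) + t(n+1) + t(n)). Induction then yields
-- 12 t(n) = (3n² − n + 1) d(n) + (−1)ⁿ (n − 1), and since m! Σ_{k<m} (−1)ᵏ/k! = d(m) − (−1)ᵐ,
-- the m-th partial sum of the stated series has an explicit numerator over m! that equals
-- 12 t(n) at m = n.

module Submission where

open import Defs
open import Data.Nat using (ℕ)
open import Data.List using (List)
open import Data.Product using (Σ; _×_)
open import Data.Fin.Permutation using (Permutation′)
open import Data.Integer using (+_)
open import Data.Rational using (ℚ; _/_)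
open import Relation.Binary.PropositionalEquality using (_≡_)

open import Data.Bool using (true; false; if_then_else_)
open import Data.Fin as Fin using (Fin; zero; suc; toℕ; punchIn)
import Data.Fin.Properties as Fin
open import Data.Fin.Permutation using (_⟨$⟩ʳ_; remove; insert; lift₀; transpose; _∘ₚ_)
import Data.Fin.Permutation as Perm
import Data.Fin.Permutation.Components as PC
open import Data.List using ([]; _∷_; [_]; _++_; map; upTo; length; filter; concatMap; tabulate; allFin)
import Data.List.Properties as List
open import Data.List.Relation.Unary.All as All using (All; []; _∷_)
import Data.List.Relation.Unary.All.Properties as All
open import Data.List.Relation.Unary.AllPairs as AllPairs using (AllPairs; []; _∷_)
import Data.List.Relation.Unary.AllPairs.Properties as AllPairs
open import Data.List.Relation.Unary.Any as Any using (Any; here; there)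
import Data.List.Relation.Unary.Any.Properties as Any
open import Data.Nat as ℕ using (zero; suc; _!; NonZero)
open import Data.Nat.ListAction using (sum)
open import Data.Nat.ListAction.Properties using (sum-++)
import Data.Nat.Properties as ℕ
open import Data.Nat.Properties using (_!≢0; m*n≢0)
open import Data.Product using (_,_; proj₁; proj₂)
import Data.Rational as ℚ
import Data.Rational.Properties as ℚ
import Data.Rational.Unnormalised as ℚᵘ
import Data.Rational.Unnormalised.Properties as ℚᵘ
open import Data.Sum as Sum using (_⊎_; inj₁; inj₂)
open import Data.Unit using (tt)
open import Function using (_∘_)
open import Level using (0ℓ)
open import Function.Bundles using (Injection)
open import Function.Properties.Inverse using (↔⇒↣)
open import Relation.Binary using (Rel; Setoid)
import Relation.Binary.Construct.On as On
open import Relation.Binary.PropositionalEquality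
  using (_≢_; refl; sym; trans; cong; cong₂; subst; _→-setoid_; module ≡-Reasoning)
open import Relation.Nullary using (Dec; yes; no; does; ¬_; contradiction)
open import Relation.Nullary.Decidable using (_×-dec_; dec-true; dec-false)
open import Relation.Unary using (Pred; Decidable)
open import Algebra.Properties.CommutativeMonoid.Sum ℕ.+-0-commutativeMonoid
  using (sum-syntax; sum-cong-≗; sum-replicate-zero; sum-remove; ∑-distrib-+; ∑-comm; ∑-permute)
open ≡-Reasoning

module Fractions where

  open import Data.Integer using (ℤ; _+_; _*_)
  open import Data.Integer.Properties using (pos-*)
  open import Data.Integer.Tactic.RingSolver using (solve-∀)
  open import Data.Rational.Unnormalised using (mkℚᵘ; *≡*; _≃_)

  private
    toℚᵘ-/ : ∀ a q → ℚ.toℚᵘ (a / suc q) ≃ mkℚᵘ a q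
    toℚᵘ-/ a q = ℚ.toℚᵘ-fromℚᵘ (mkℚᵘ a q)

  *≡*⇒/≡/ : ∀ a b q r .{{_ : NonZero q}} .{{_ : NonZero r}} → a * + r ≡ b * + q → a / q ≡ b / r
  *≡*⇒/≡/ a b (suc q) (suc r) eq = ℚ.toℚᵘ-injective
    (ℚᵘ.≃-trans (toℚᵘ-/ a q) (ℚᵘ.≃-trans (*≡* eq) (ℚᵘ.≃-sym (toℚᵘ-/ b r))))

  /+/≡+/ : ∀ a b q .{{_ : NonZero q}} → (a / q) ℚ.+ (b / q) ≡ (a + b) / q
  /+/≡+/ a b (suc q) = ℚ.toℚᵘ-injective
    (ℚᵘ.≃-trans (ℚ.toℚᵘ-homo-+ (a / suc q) (b / suc q))
    (ℚᵘ.≃-trans (ℚᵘ.+-cong (toℚᵘ-/ a q) (toℚᵘ-/ b q))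
    (ℚᵘ.≃-trans (*≡* (trans (identity a b (+ suc q)) (cong ((a + b) *_) (sym (pos-* (suc q) (suc q))))))
    (ℚᵘ.≃-sym (toℚᵘ-/ (a + b) q)))))
    where
    identity : ∀ a b Q → (a * Q + b * Q) * Q ≡ (a + b) * (Q * Q)
    identity = solve-∀

  /*/≡*/ : ∀ a b q r .{{_ : NonZero q}} .{{_ : NonZero r}} →
          (a / q) ℚ.* (b / r) ≡ ((a * b) / (q ℕ.* r)) {{m*n≢0 q r}}
  /*/≡*/ a b (suc q) (suc r) = ℚ.toℚᵘ-injective
    (ℚᵘ.≃-trans (ℚ.toℚᵘ-homo-* (a / suc q) (b / suc r))
    (ℚᵘ.≃-trans (ℚᵘ.*-cong (toℚᵘ-/ a q) (toℚᵘ-/ b r))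
    (ℚᵘ.≃-sym (toℚᵘ-/ (a * b) (r ℕ.+ q ℕ.* suc r)))))

  sumℚ-++ : ∀ xs ys → sumℚ (xs ++ ys) ≡ sumℚ xs ℚ.+ sumℚ ys
  sumℚ-++ []       ys = sym (ℚ.+-identityˡ (sumℚ ys))
  sumℚ-++ (x ∷ xs) ys = trans (cong (x ℚ.+_) (sumℚ-++ xs ys)) (sym (ℚ.+-assoc x (sumℚ xs) (sumℚ ys)))

open Fractions

module ClosedForm
  (d t : ℕ → ℕ)
  (d-0 : d 0 ≡ 1) (d-1 : d 1 ≡ 0) (t-0 : t 0 ≡ 0) (t-1 : t 1 ≡ 0)
  (d-rec : ∀ n → d (suc (suc n)) ≡ suc n ℕ.* (d (suc n) ℕ.+ d n))
  (t-rec : ∀ n → t (suc (suc n)) ℕ.+ 2 ℕ.* t (suc n) ≡ suc n ℕ.* (d (suc (suc n)) ℕ.+ t (suc n) ℕ.+ t n))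
  where

  open import Data.Integer using (ℤ; _+_; _*_; _-_; -_; 1ℤ)
  open import Data.Integer.Properties using (pos-+; pos-*; *-zeroʳ)
  open import Data.Integer.Tactic.RingSolver using (solve-∀)

  quadratic : ℤ → ℤ
  quadratic N = + 3 * N * N - N + 1ℤ

  d-recℤ : ∀ n → + d (suc (suc n)) ≡ + suc n * (+ d (suc n) + + d n)
  d-recℤ n = trans (cong +_ (d-rec n)) (trans (pos-* (suc n) _) (cong (+ suc n *_) (pos-+ (d (suc n)) (d n))))

  t-recℤ : ∀ n → + t (suc (suc n)) + + 2 * + t (suc n) ≡ + suc n * (+ d (suc (suc n)) + + t (suc n) + + t n)
  t-recℤ n = begin
      + t₂ + + 2 * + t₁                  ≡⟨ cong (λ x → + t₂ + x) (pos-* 2 t₁) ⟨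
      + t₂ + + (2 ℕ.* t₁)                ≡⟨ pos-+ t₂ _ ⟨
      + (t₂ ℕ.+ 2 ℕ.* t₁)                ≡⟨ cong +_ (t-rec n) ⟩
      + (suc n ℕ.* (d₂ ℕ.+ t₁ ℕ.+ t₀))   ≡⟨ pos-* (suc n) _ ⟩
      + suc n * + (d₂ ℕ.+ t₁ ℕ.+ t₀)     ≡⟨ cong (+ suc n *_) (trans (pos-+ (d₂ ℕ.+ t₁) t₀)
                                                                 (cong (_+ + t₀) (pos-+ d₂ t₁))) ⟩
      + suc n * (+ d₂ + + t₁ + + t₀)     ∎
    where
    t₂ = t (suc (suc n)); t₁ = t (suc n); t₀ = t n; d₂ = d (suc (suc n))

  d-closed : ∀ n → + d (suc n) ≡ + suc n * + d n + sgn (suc n)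
  d-closed zero rewrite d-0 | d-1 = refl
  d-closed (suc n) = trans (d-recℤ n) (propagate (+ suc n) (+ d n) (sgn (suc n)) (d-closed n))
    where
    propagate : ∀ M b s {a} → a ≡ M * b + s → M * (a + b) ≡ (1ℤ + M) * a + - s
    propagate M b s refl = identity M b s
      where
      identity : ∀ M b s → M * ((M * b + s) + b) ≡ (1ℤ + M) * (M * b + s) + - s
      identity = solve-∀

  t-closed : ∀ n → + 12 * + t n ≡ quadratic (+ n) * + d n + sgn n * (+ n - 1ℤ)
  t-closed zero rewrite t-0 | d-0 = refl
  t-closed (suc zero) rewrite t-1 | d-1 = refl
  t-closed (suc (suc n)) =
    propagate (+ n) (+ d n) (sgn n) (d-closed n) (d-recℤ n) (t-recℤ n) (t-closed (suc n)) (t-closed n)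
    where
    propagate : ∀ N b s {a d₂ t₀ t₁ t₂} →
      a ≡ (1ℤ + N) * b + - s →
      d₂ ≡ (1ℤ + N) * (a + b) →
      t₂ + + 2 * t₁ ≡ (1ℤ + N) * (d₂ + t₁ + t₀) →
      + 12 * t₁ ≡ quadratic (1ℤ + N) * a + - s * (1ℤ + N - 1ℤ) →
      + 12 * t₀ ≡ quadratic N * b + s * (N - 1ℤ) →
      + 12 * t₂ ≡ quadratic (1ℤ + (1ℤ + N)) * d₂ + - - s * (1ℤ + (1ℤ + N) - 1ℤ)
    propagate N b s {t₀ = t₀} {t₁} {t₂} refl refl rec h₁ h₀ = begin
        + 12 * t₂
      ≡⟨ isolate t₂ t₁ ⟩
        + 12 * (t₂ + + 2 * t₁) - + 2 * (+ 12 * t₁)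
      ≡⟨ cong (λ x → + 12 * x - + 2 * (+ 12 * t₁)) rec ⟩
        + 12 * ((1ℤ + N) * (d₂ + t₁ + t₀)) - + 2 * (+ 12 * t₁)
      ≡⟨ regroup N d₂ t₀ t₁ ⟩
        + 12 * (1ℤ + N) * d₂ + (N - 1ℤ) * (+ 12 * t₁) + (1ℤ + N) * (+ 12 * t₀)
      ≡⟨ cong₂ (λ x y → + 12 * (1ℤ + N) * d₂ + (N - 1ℤ) * x + (1ℤ + N) * y) h₁ h₀ ⟩
        + 12 * (1ℤ + N) * d₂ + (N - 1ℤ) * (quadratic (1ℤ + N) * a + - s * (1ℤ + N - 1ℤ))
          + (1ℤ + N) * (quadratic N * b + s * (N - 1ℤ))
      ≡⟨ identity N b s ⟩
        quadratic (1ℤ + (1ℤ + N)) * d₂ + - - s * (1ℤ + (1ℤ + N) - 1ℤ)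
      ∎
      where
      a = (1ℤ + N) * b + - s
      d₂ = (1ℤ + N) * (a + b)
      isolate : ∀ t₂ t₁ → + 12 * t₂ ≡ + 12 * (t₂ + + 2 * t₁) - + 2 * (+ 12 * t₁)
      isolate = solve-∀
      regroup : ∀ N d₂ t₀ t₁ → + 12 * ((1ℤ + N) * (d₂ + t₁ + t₀)) - + 2 * (+ 12 * t₁)
                              ≡ + 12 * (1ℤ + N) * d₂ + (N - 1ℤ) * (+ 12 * t₁) + (1ℤ + N) * (+ 12 * t₀)
      regroup = solve-∀
      identity : ∀ N b s → let a = (1ℤ + N) * b + - s; d₂ = (1ℤ + N) * (a + b) in
        + 12 * (1ℤ + N) * d₂
          + (N - 1ℤ) * ((+ 3 * (1ℤ + N) * (1ℤ + N) - (1ℤ + N) + 1ℤ) * a + - s * (1ℤ + N - 1ℤ))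
          + (1ℤ + N) * ((+ 3 * N * N - N + 1ℤ) * b + s * (N - 1ℤ))
        ≡ (+ 3 * (1ℤ + (1ℤ + N)) * (1ℤ + (1ℤ + N)) - (1ℤ + (1ℤ + N)) + 1ℤ) * d₂
          + - - s * (1ℤ + (1ℤ + N) - 1ℤ)
      identity = solve-∀

  _/!_ : ℤ → ℕ → ℚ
  a /! m = (a / m !) {{m !≢0}}

  -- term n k is definitionally termℤ n k /! k.
  termℤ : ℕ → ℕ → ℤ
  termℤ n k = sgn k * + (3 ℕ.* n ℕ.+ k) * (+ n - + k - 1ℤ)

  partialSumNumerator : ℕ → ℕ → ℤ
  partialSumNumerator n m = quadratic (+ n) * (+ d m - sgn m) + sgn m * (+ m * (+ m + + 2 * + n))

  partialSumNumerator-suc : ∀ n m → partialSumNumerator n (suc m) ≡ + suc m * (partialSumNumerator n m + termℤ n m)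
  partialSumNumerator-suc n m = begin
      quadratic N * (+ d (suc m) - - s) + - s * ((1ℤ + M) * ((1ℤ + M) + + 2 * N))
    ≡⟨ cong (λ a → quadratic N * (a - - s) + - s * ((1ℤ + M) * ((1ℤ + M) + + 2 * N))) (d-closed m) ⟩
      quadratic N * ((1ℤ + M) * + d m + - s - - s) + - s * ((1ℤ + M) * ((1ℤ + M) + + 2 * N))
    ≡⟨ identity N M (+ d m) s ⟩
      (1ℤ + M) * (quadratic N * (+ d m - s) + s * (M * (M + + 2 * N)) + s * (+ 3 * N + M) * (N - M - 1ℤ))
    ≡⟨ cong (λ x → (1ℤ + M) * (partialSumNumerator n m + s * x * (N - M - 1ℤ))) 3n+m≡ ⟨
      + suc m * (partialSumNumerator n m + termℤ n m)
    ∎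
    where
    N = + n; M = + m; s = sgn m
    3n+m≡ : + (3 ℕ.* n ℕ.+ m) ≡ + 3 * N + M
    3n+m≡ = trans (pos-+ (3 ℕ.* n) m) (cong (_+ M) (pos-* 3 n))
    identity : ∀ N M b s →
      (+ 3 * N * N - N + 1ℤ) * ((1ℤ + M) * b + - s - - s) + - s * ((1ℤ + M) * ((1ℤ + M) + + 2 * N))
      ≡ (1ℤ + M) * ((+ 3 * N * N - N + 1ℤ) * (b - s) + s * (M * (M + + 2 * N)) + s * (+ 3 * N + M) * (N - M - 1ℤ))
    identity = solve-∀

  partialSumNumerator-diag : ∀ n → partialSumNumerator n n ≡ + 12 * + t n
  partialSumNumerator-diag n = trans (identity (+ n) (+ d n) (sgn n)) (sym (t-closed n))
    where
    identity : ∀ N b s → (+ 3 * N * N - N + 1ℤ) * (b - s) + s * (N * (N + + 2 * N))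
                         ≡ (+ 3 * N * N - N + 1ℤ) * b + s * (N - 1ℤ)
    identity = solve-∀

  sumℚ-term : ∀ n m → sumℚ (map (term n) (upTo m)) ≡ partialSumNumerator n m /! m
  sumℚ-term n zero = trans (sym (ℚ.0/n≡0 1)) (cong (_/ 1) (sym partialSumNumerator-zero))
    where
    partialSumNumerator-zero : partialSumNumerator n 0 ≡ + 0
    partialSumNumerator-zero rewrite d-0 | *-zeroʳ (quadratic (+ n)) = refl
  sumℚ-term n (suc m) = begin
      sumℚ (map (term n) (upTo (suc m)))
    ≡⟨ cong (sumℚ ∘ map (term n)) (List.upTo-∷ʳ m) ⟨
      sumℚ (map (term n) (upTo m ++ [ m ]))
    ≡⟨ cong sumℚ (List.map-++ (term n) (upTo m) [ m ]) ⟩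
      sumℚ (map (term n) (upTo m) ++ [ term n m ])
    ≡⟨ sumℚ-++ (map (term n) (upTo m)) [ term n m ] ⟩
      sumℚ (map (term n) (upTo m)) ℚ.+ (term n m ℚ.+ ℚ.0ℚ)
    ≡⟨ cong₂ ℚ._+_ (sumℚ-term n m) (ℚ.+-identityʳ (term n m)) ⟩
      partialSumNumerator n m /! m ℚ.+ termℤ n m /! m
    ≡⟨ /+/≡+/ (partialSumNumerator n m) (termℤ n m) (m !) {{m !≢0}} ⟩
      (partialSumNumerator n m + termℤ n m) /! m
    ≡⟨ *≡*⇒/≡/ (partialSumNumerator n m + termℤ n m) (partialSumNumerator n (suc m))
                (m !) (suc m !) {{m !≢0}} {{suc m !≢0}} cross ⟩
      partialSumNumerator n (suc m) /! suc m
    ∎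
    where
    cross : (partialSumNumerator n m + termℤ n m) * + (suc m !) ≡ partialSumNumerator n (suc m) * + (m !)
    cross = begin
        (partialSumNumerator n m + termℤ n m) * + (suc m ℕ.* m !)
      ≡⟨ cong ((partialSumNumerator n m + termℤ n m) *_) (pos-* (suc m) (m !)) ⟩
        (partialSumNumerator n m + termℤ n m) * (+ suc m * + (m !))
      ≡⟨ identity (partialSumNumerator n m + termℤ n m) (+ suc m) (+ (m !)) ⟩
        + suc m * (partialSumNumerator n m + termℤ n m) * + (m !)
      ≡⟨ cong (_* + (m !)) (partialSumNumerator-suc n m) ⟨
        partialSumNumerator n (suc m) * + (m !)
      ∎
      where
      identity : ∀ x K F → x * (K * F) ≡ K * x * F
      identity = solve-∀

  rhs≡t : ∀ n → rhs n ≡ + t n / 1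
  rhs≡t n = begin
      (+ (n !) / 12) ℚ.* sumℚ (map (term n) (upTo n))
    ≡⟨ cong ((+ (n !) / 12) ℚ.*_) (sumℚ-term n n) ⟩
      (+ (n !) / 12) ℚ.* (partialSumNumerator n n /! n)
    ≡⟨ cong (λ x → (+ (n !) / 12) ℚ.* (x /! n)) (partialSumNumerator-diag n) ⟩
      (+ (n !) / 12) ℚ.* ((+ 12 * + t n) /! n)
    ≡⟨ /*/≡*/ (+ (n !)) (+ 12 * + t n) 12 (n !) {{_}} {{n !≢0}} ⟩
      ((+ (n !) * (+ 12 * + t n)) / (12 ℕ.* n !)) {{12n!≢0}}
    ≡⟨ *≡*⇒/≡/ (+ (n !) * (+ 12 * + t n)) (+ t n) (12 ℕ.* n !) 1 {{12n!≢0}} cross ⟩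
      + t n / 1
    ∎
    where
    12n!≢0 = m*n≢0 12 (n !) {{_}} {{n !≢0}}
    cross : + (n !) * (+ 12 * + t n) * + 1 ≡ + t n * + (12 ℕ.* n !)
    cross = trans (identity (+ (n !)) (+ t n)) (cong (+ t n *_) (sym (pos-* 12 (n !))))
      where
      identity : ∀ F T → F * (+ 12 * T) * + 1 ≡ T * (+ 12 * F)
      identity = solve-∀

-- ℕ arithmetic is opened only from here on: the modules above use the ℤ operators of the same names.
open import Data.Nat using (_+_; _*_)
open import Data.Nat.Tactic.RingSolver using (solve-∀)

-- Indicators and sums over lists

χ : ∀ {p} {P : Set p} → Dec P → ℕ
χ P? = if does P? then 1 else 0

χ-⇔ : ∀ {p q} {P : Set p} {Q : Set q} (P? : Dec P) (Q? : Dec Q) → (P → Q) → (Q → P) → χ P? ≡ χ Q?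
χ-⇔ (yes _) (yes _) _   _   = refl
χ-⇔ (yes p) (no ¬q) p→q _   = contradiction (p→q p) ¬q
χ-⇔ (no ¬p) (yes q) _   q→p = contradiction (q→p q) ¬p
χ-⇔ (no _)  (no _)  _   _   = refl

χ-no : ∀ {p} {P : Set p} (P? : Dec P) → ¬ P → χ P? ≡ 0
χ-no P? ¬p = χ-⇔ P? (no ¬p) (λ p → p) (λ p → p)

χ-×-dec : ∀ {p q} {P : Set p} {Q : Set q} (P? : Dec P) (Q? : Dec Q) → χ (P? ×-dec Q?) ≡ χ P? * χ Q?
χ-×-dec (yes _) (yes _) = refl
χ-×-dec (yes _) (no _)  = refl
χ-×-dec (no _)  _       = refl

length-filter : ∀ {a p} {A : Set a} {P : Pred A p} (P? : Decidable P) xs →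
                length (filter P? xs) ≡ sum (map (χ ∘ P?) xs)
length-filter P? [] = refl
length-filter P? (x ∷ xs) with does (P? x)
... | true  = cong suc (length-filter P? xs)
... | false = length-filter P? xs

sum-map-concatMap : ∀ {a b} {A : Set a} {B : Set b} (h : B → ℕ) (f : A → List B) xs →
                    sum (map h (concatMap f xs)) ≡ sum (map (sum ∘ map h ∘ f) xs)
sum-map-concatMap h f [] = refl
sum-map-concatMap h f (x ∷ xs) = begin
  sum (map h (f x ++ concatMap f xs))                ≡⟨ cong sum (List.map-++ h (f x) _) ⟩
  sum (map h (f x) ++ map h (concatMap f xs))        ≡⟨ sum-++ (map h (f x)) _ ⟩
  sum (map h (f x)) + sum (map h (concatMap f xs))   ≡⟨ cong (_+_ (sum (map h (f x)))) (sum-map-concatMap h f xs) ⟩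
  sum (map h (f x)) + sum (map (sum ∘ map h ∘ f) xs) ∎

sum-map-tabulate : ∀ {a} {A : Set a} {n} (h : A → ℕ) (f : Fin n → A) →
                   sum (map h (tabulate f)) ≡ ∑[ i < n ] h (f i)
sum-map-tabulate {n = zero}  h f = refl
sum-map-tabulate {n = suc n} h f = cong (_+_ (h (f zero))) (sum-map-tabulate h (f ∘ suc))

sum-map-linear : ∀ {a} {A : Set a} (f g : A → ℕ) {k c l} → (∀ x → f x + k * g x ≡ c + l * g x) →
                 ∀ xs → sum (map f xs) + k * sum (map g xs) ≡ c * length xs + l * sum (map g xs)
sum-map-linear f g {k} {c} {l} eq []       = identity k c l
  where
  identity : ∀ k c l → 0 + k * 0 ≡ c * 0 + l * 0
  identity = solve-∀
sum-map-linear f g {k} {c} {l} eq (x ∷ xs) = begin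
    f x + sum (map f xs) + k * (g x + sum (map g xs))
  ≡⟨ split (f x) (sum (map f xs)) k (g x) (sum (map g xs)) ⟩
    (f x + k * g x) + (sum (map f xs) + k * sum (map g xs))
  ≡⟨ cong₂ _+_ (eq x) (sum-map-linear f g {k} {c} {l} eq xs) ⟩
    (c + l * g x) + (c * length xs + l * sum (map g xs))
  ≡⟨ merge c l (g x) (length xs) (sum (map g xs)) ⟩
    c * suc (length xs) + l * (g x + sum (map g xs))
  ∎
  where
  split : ∀ fx F k gx G → fx + F + k * (gx + G) ≡ (fx + k * gx) + (F + k * G)
  split = solve-∀
  merge : ∀ c l gx n G → (c + l * gx) + (c * n + l * G) ≡ c * suc n + l * (gx + G)
  merge = solve-∀

module _ {a b} {A : Set a} {B : Set b} {m} (g : A → Fin m → B) where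

  All-concatMap-tabulate : ∀ {p q} {P : Pred A p} {Q : Pred B q} → (∀ {a} → P a → ∀ x → Q (g a x)) →
                           ∀ {xs} → All P xs → All Q (concatMap (tabulate ∘ g) xs)
  All-concatMap-tabulate Q-g = All.concat⁺ ∘ All.map⁺ ∘ All.map (All.tabulate⁺ ∘ Q-g)

  Any-concatMap-tabulate : ∀ {p q} {P : Pred A p} {Q : Pred B q} x → (∀ {a} → P a → Q (g a x)) →
                           ∀ {xs} → Any P xs → Any Q (concatMap (tabulate ∘ g) xs)
  Any-concatMap-tabulate x Q-g = Any.concatMap⁺ (tabulate ∘ g) ∘ Any.map (Any.tabulate⁺ x ∘ Q-g)

  AllPairs-concatMap-tabulate : ∀ {r s} {R : Rel A r} {S : Rel B s} →
    (∀ a {x y} → x ≢ y → S (g a x) (g a y)) → (∀ {a a′} → R a a′ → ∀ x y → S (g a x) (g a′ y)) →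
    ∀ {xs} → AllPairs R xs → AllPairs S (concatMap (tabulate ∘ g) xs)
  AllPairs-concatMap-tabulate S-within S-across {xs} Rxs = AllPairs.concat⁺
    (All.map⁺ (All.universal (λ a → AllPairs.tabulate⁺ (S-within a)) xs))
    (AllPairs.map⁺ (AllPairs.map (λ Raa′ → All.tabulate⁺ λ x → All.tabulate⁺ λ y → S-across Raa′ x y) Rxs))

  length-concatMap-tabulate : ∀ xs → length (concatMap (tabulate ∘ g) xs) ≡ m * length xs
  length-concatMap-tabulate []       = sym (ℕ.*-zeroʳ m)
  length-concatMap-tabulate (a ∷ xs) = begin
      length (tabulate (g a) ++ concatMap (tabulate ∘ g) xs)
    ≡⟨ List.length-++ (tabulate (g a)) ⟩
      length (tabulate (g a)) + length (concatMap (tabulate ∘ g) xs)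
    ≡⟨ cong₂ _+_ (List.length-tabulate (g a)) (length-concatMap-tabulate xs) ⟩
      m + m * length xs
    ≡⟨ ℕ.*-suc m (length xs) ⟨
      m * suc (length xs)
    ∎

  sum-map-concatMap-tabulate : ∀ (h : B → ℕ) xs →
    sum (map h (concatMap (tabulate ∘ g) xs)) ≡ sum (map (λ a → ∑[ x < m ] h (g a x)) xs)
  sum-map-concatMap-tabulate h xs = trans (sum-map-concatMap h (tabulate ∘ g) xs)
    (cong sum (List.map-cong (λ a → sum-map-tabulate h (g a)) xs))

module _ {a p} {A : Set a} {P : Pred A p} where

  sum-map-─ : ∀ (h : A → ℕ) {xs} (i : Any P xs) → sum (map h xs) ≡ h (Any.lookup i) + sum (map h (xs Any.─ i))
  sum-map-─ h (here _) = refl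
  sum-map-─ h {x ∷ xs} (there i) =
    trans (cong (_+_ (h x)) (sum-map-─ h i)) (swap (h x) (h (Any.lookup i)) (sum (map h (xs Any.─ i))))
    where
    swap : ∀ a b c → a + (b + c) ≡ b + (a + c)
    swap = solve-∀

  Any-─ : ∀ {q} {Q : Pred A q} {xs} (i : Any P xs) → Any Q xs → Q (Any.lookup i) ⊎ Any Q (xs Any.─ i)
  Any-─ (here _)  (here q)  = inj₁ q
  Any-─ (here _)  (there q) = inj₂ q
  Any-─ (there i) (here q)  = inj₂ (here q)
  Any-─ (there i) (there q) = Sum.map₂ there (Any-─ i q)

  AllPairs-─ : ∀ {r} {R : Rel A r} {xs} (i : Any P xs) → AllPairs R xs → AllPairs R (xs Any.─ i)
  AllPairs-─ (here _)  (_  ∷ Rxs) = Rxs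
  AllPairs-─ (there i) (Rx ∷ Rxs) = All.─⁺ i Rx ∷ AllPairs-─ i Rxs

  AllPairs-lookup-─ : ∀ {r} {R : Rel A r} → (∀ {x y} → R x y → R y x) →
                      ∀ {xs} (i : Any P xs) → AllPairs R xs → All (R (Any.lookup i)) (xs Any.─ i)
  AllPairs-lookup-─ R-sym (here _)  (Rx ∷ _)   = Rx
  AllPairs-lookup-─ R-sym (there i) (Rx ∷ Rxs) = R-sym (proj₁ (All.lookupAny Rx i)) ∷ AllPairs-lookup-─ R-sym i Rxs

module _ {a ℓ} (S : Setoid a ℓ) where

  open Setoid S using (_≈_) renaming (Carrier to A; sym to ≈-sym; trans to ≈-trans)
  open import Data.List.Relation.Unary.Unique.Setoid S using (Unique)

  unique-cover⇒sum-map-≡ : ∀ (h : A → ℕ) → (∀ {x y} → x ≈ y → h x ≡ h y) →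
    ∀ {xs ys} → Unique xs → Unique ys → All (λ x → Any (_≈ x) ys) xs → All (λ y → Any (_≈ y) xs) ys →
    sum (map h xs) ≡ sum (map h ys)
  unique-cover⇒sum-map-≡ h h-cong {[]}     {[]}     _ _ _ _ = refl
  unique-cover⇒sum-map-≡ h h-cong {[]}     {_ ∷ _}  _ _ _ (() ∷ _)
  unique-cover⇒sum-map-≡ h h-cong {x ∷ xs} {ys} (x≉xs ∷ xs!) ys! (x∈ys ∷ xs⊆ys) ys⊆x∷xs = begin
      h x + sum (map h xs)
    ≡⟨ cong₂ _+_ (h-cong (≈-sym y≈x))
                 (unique-cover⇒sum-map-≡ h h-cong xs! (AllPairs-─ x∈ys ys!) xs⊆ys′ ys′⊆xs) ⟩
      h y + sum (map h ys′)
    ≡⟨ sum-map-─ h x∈ys ⟨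
      sum (map h ys)
    ∎
    where
    y = Any.lookup x∈ys
    ys′ = ys Any.─ x∈ys
    y≈x : y ≈ x
    y≈x = Any.lookup-result x∈ys
    xs⊆ys′ : All (λ x′ → Any (_≈ x′) ys′) xs
    xs⊆ys′ = All.zipWith (λ (x≉x′ , x′∈ys) → drop-y x≉x′ x′∈ys) (x≉xs , xs⊆ys)
      where
      drop-y : ∀ {x′} → ¬ x ≈ x′ → Any (_≈ x′) ys → Any (_≈ x′) ys′
      drop-y x≉x′ x′∈ys with Any-─ x∈ys x′∈ys
      ... | inj₁ y≈x′   = contradiction (≈-trans (≈-sym y≈x) y≈x′) x≉x′
      ... | inj₂ x′∈ys′ = x′∈ys′
    ys′⊆xs : All (λ y′ → Any (_≈ y′) xs) ys′
    ys′⊆xs = All.zipWith (λ (y≉y′ , y′∈x∷xs) → drop-x y≉y′ y′∈x∷xs)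
                         (AllPairs-lookup-─ (λ y≉y′ y′≈y → y≉y′ (≈-sym y′≈y)) x∈ys ys! , All.─⁺ x∈ys ys⊆x∷xs)
      where
      drop-x : ∀ {y′} → ¬ y ≈ y′ → Any (_≈ y′) (x ∷ xs) → Any (_≈ y′) xs
      drop-x y≉y′ (here x≈y′)  = contradiction (≈-trans y≈x x≈y′) y≉y′
      drop-x y≉y′ (there y′∈xs) = y′∈xs

∑-const : ∀ m c → ∑[ i < m ] c ≡ m * c
∑-const zero    c = refl
∑-const (suc m) c = cong (_+_ c) (∑-const m c)

∑-odd : ∀ m → ∑[ i < m ] suc (toℕ i + toℕ i) ≡ m * m
∑-odd zero    = refl
∑-odd (suc m) = cong suc (begin
    ∑[ i < m ] suc (suc (toℕ i) + suc (toℕ i))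
  ≡⟨ sum-cong-≗ {m} (λ i → cong (_+_ 2) (ℕ.+-suc (toℕ i) (toℕ i))) ⟩
    ∑[ i < m ] (2 + suc (toℕ i + toℕ i))
  ≡⟨ ∑-distrib-+ {m} (λ _ → 2) (λ i → suc (toℕ i + toℕ i)) ⟩
    ∑[ i < m ] 2 + ∑[ i < m ] suc (toℕ i + toℕ i)
  ≡⟨ cong₂ _+_ (∑-const m 2) (∑-odd m) ⟩
    m * 2 + m * m
  ≡⟨ identity m ⟩
    m + m * suc m
  ∎)
  where
  identity : ∀ m → m * 2 + m * m ≡ m + m * suc m
  identity = solve-∀

∑-suc[σ+id] : ∀ {m} (σ : Permutation′ m) → ∑[ x < m ] suc (toℕ (σ ⟨$⟩ʳ x) + toℕ x) ≡ m * m
∑-suc[σ+id] {m} σ = begin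
    ∑[ x < m ] (suc (toℕ (σ ⟨$⟩ʳ x)) + toℕ x)
  ≡⟨ ∑-distrib-+ {m} (λ x → suc (toℕ (σ ⟨$⟩ʳ x))) toℕ ⟩
    ∑[ x < m ] suc (toℕ (σ ⟨$⟩ʳ x)) + ∑[ x < m ] toℕ x
  ≡⟨ cong (_+ ∑[ x < m ] toℕ x) (∑-permute (suc ∘ toℕ) σ) ⟨
    ∑[ x < m ] suc (toℕ x) + ∑[ x < m ] toℕ x
  ≡⟨ ∑-distrib-+ {m} (suc ∘ toℕ) toℕ ⟨
    ∑[ x < m ] suc (toℕ x + toℕ x)
  ≡⟨ ∑-odd m ⟩
    m * m
  ∎

χ< : ∀ {m} → Fin m → Fin m → ℕ
χ< i j = χ (i Fin.<? j)

χ<-irrefl : ∀ {m} (i : Fin m) → χ< i i ≡ 0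
χ<-irrefl i = χ-no (i Fin.<? i) (ℕ.<-irrefl refl)

χ<-zeroʳ : ∀ {m} (i : Fin (suc m)) → χ< i zero ≡ 0
χ<-zeroʳ {m} i = χ-no (i Fin.<? Fin.zero {m}) λ ()

χ<-zeroˡ : ∀ {m} {i : Fin (suc m)} → i ≢ zero → χ< zero i ≡ 1
χ<-zeroˡ {i = zero}  i≢0 = contradiction refl i≢0
χ<-zeroˡ {i = suc i} _   = refl

χ<-punchIn : ∀ {m} (k : Fin (suc m)) (i j : Fin m) → χ< (punchIn k i) (punchIn k j) ≡ χ< i j
χ<-punchIn k i j = χ-⇔ (punchIn k i Fin.<? punchIn k j) (i Fin.<? j)
  (λ k+i<k+j → ℕ.≰⇒> λ j≤i → ℕ.<⇒≱ k+i<k+j (Fin.punchIn-mono-≤ k j i j≤i))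
  (λ i<j → ℕ.≰⇒> λ k+j≤k+i → ℕ.<⇒≱ i<j (Fin.punchIn-cancel-≤ k j i k+j≤k+i))

∑-χ< : ∀ m (j : Fin m) → ∑[ i < m ] χ< i j ≡ toℕ j
∑-χ< (suc m) zero    = sum-replicate-zero (suc m)
∑-χ< (suc m) (suc j) = cong suc (trans (sum-cong-≗ {m} (λ i → χ<-punchIn zero i j)) (∑-χ< m j))

∀-punchIn : ∀ {m} (P : Fin (suc m) → Set) i → P i → (∀ j → P (punchIn i j)) → ∀ k → P k
∀-punchIn P i Pi P-punchIn k with k Fin.≟ i
... | yes refl = Pi
... | no  k≢i  = subst P (Fin.punchIn-punchOut (k≢i ∘ sym)) (P-punchIn (Fin.punchOut (k≢i ∘ sym)))

remove-⟨$⟩ʳ : ∀ {n} (π : Permutation′ (suc n)) i {j v} →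
              π ⟨$⟩ʳ punchIn i j ≡ punchIn (π ⟨$⟩ʳ i) v → remove i π ⟨$⟩ʳ j ≡ v
remove-⟨$⟩ʳ π i {j} {v} eq = Fin.punchIn-injective (π ⟨$⟩ʳ i) _ v (trans (sym (Perm.punchIn-permute π i j)) eq)

insert-at : ∀ {m n} (i : Fin (suc m)) (j : Fin (suc n)) (π : Perm.Permutation m n) → insert i j π ⟨$⟩ʳ i ≡ j
insert-at i j π with i Fin.≟ i
... | yes _   = refl
... | no  i≢i = contradiction refl i≢i

insert-cong : ∀ {m n} (x : Fin (suc m)) (y : Fin (suc n)) {τ τ′ : Perm.Permutation m n} →
              (∀ i → τ ⟨$⟩ʳ i ≡ τ′ ⟨$⟩ʳ i) → ∀ k → insert x y τ ⟨$⟩ʳ k ≡ insert x y τ′ ⟨$⟩ʳ k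
insert-cong x y {τ} {τ′} τ≈τ′ = ∀-punchIn (λ k → insert x y τ ⟨$⟩ʳ k ≡ insert x y τ′ ⟨$⟩ʳ k) x
  (trans (insert-at x y τ) (sym (insert-at x y τ′)))
  (λ j → trans (Perm.insert-punchIn x y τ j) (trans (cong (punchIn y) (τ≈τ′ j)) (sym (Perm.insert-punchIn x y τ′ j))))

insert-injective : ∀ {m n} (x : Fin (suc m)) (y : Fin (suc n)) {τ τ′ : Perm.Permutation m n} →
                   (∀ k → insert x y τ ⟨$⟩ʳ k ≡ insert x y τ′ ⟨$⟩ʳ k) → ∀ i → τ ⟨$⟩ʳ i ≡ τ′ ⟨$⟩ʳ i
insert-injective x y {τ} {τ′} eq i = Fin.punchIn-injective y _ _
  (trans (sym (Perm.insert-punchIn x y τ i)) (trans (eq (punchIn x i)) (Perm.insert-punchIn x y τ′ i)))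

insert-derangement : ∀ {n} (x : Fin (suc n)) (τ : Permutation′ n) → Derangement τ →
                     ∀ i → i ≢ x → insert x x τ ⟨$⟩ʳ i ≢ i
insert-derangement x τ τ-der = ∀-punchIn (λ i → i ≢ x → insert x x τ ⟨$⟩ʳ i ≢ i) x
  (λ x≢x → contradiction refl x≢x)
  (λ j _ eq → τ-der j (Fin.punchIn-injective x _ _ (trans (sym (Perm.insert-punchIn x x τ j)) eq)))

-- Inversions

inverted : ∀ {n} → Permutation′ n → Fin n → Fin n → ℕ
inverted π i j = χ< i j * χ< (π ⟨$⟩ʳ j) (π ⟨$⟩ʳ i)

inversions : ∀ {n} → Permutation′ n → ℕ
inversions {n} π = ∑[ i < n ] ∑[ j < n ] inverted π i j

inv≡inversions : ∀ {n} (π : Permutation′ n) → inv π ≡ inversions π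
inv≡inversions {n} π = begin
    length (filter isInversion? pairs)
  ≡⟨ length-filter isInversion? pairs ⟩
    sum (map (χ ∘ isInversion?) pairs)
  ≡⟨ sum-map-concatMap (χ ∘ isInversion?) row (allFin n) ⟩
    sum (map (sum ∘ map (χ ∘ isInversion?) ∘ row) (allFin n))
  ≡⟨ sum-map-tabulate (sum ∘ map (χ ∘ isInversion?) ∘ row) (λ i → i) ⟩
    ∑[ i < n ] sum (map (χ ∘ isInversion?) (row i))
  ≡⟨ sum-cong-≗ {n} sum-row ⟩
    ∑[ i < n ] ∑[ j < n ] χ (isInversion? (i , j))
  ≡⟨ sum-cong-≗ {n} (λ i → sum-cong-≗ {n} λ j → χ-×-dec (i Fin.<? j) (π ⟨$⟩ʳ j Fin.<? π ⟨$⟩ʳ i)) ⟩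
    inversions π
  ∎
  where
  row : Fin n → List (Fin n × Fin n)
  row i = map (i ,_) (allFin n)
  pairs = concatMap row (allFin n)
  isInversion? : ∀ p → Dec ((proj₁ p Fin.< proj₂ p) × (π ⟨$⟩ʳ proj₂ p Fin.< π ⟨$⟩ʳ proj₁ p))
  isInversion? (i , j) = (i Fin.<? j) ×-dec (π ⟨$⟩ʳ j Fin.<? π ⟨$⟩ʳ i)
  sum-row : ∀ i → sum (map (χ ∘ isInversion?) (row i)) ≡ ∑[ j < n ] χ (isInversion? (i , j))
  sum-row i = trans (cong sum (sym (List.map-∘ (allFin n))))
                    (sum-map-tabulate {n = n} (χ ∘ isInversion? ∘ (i ,_)) (λ j → j))

inversions-cong : ∀ {n} {π σ : Permutation′ n} → SamePerm π σ → inversions π ≡ inversions σ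
inversions-cong {n} π≈σ =
  sum-cong-≗ {n} λ i → sum-cong-≗ {n} λ j → cong₂ (λ u v → χ< i j * χ< u v) (π≈σ j) (π≈σ i)

inverted-diag : ∀ {n} (π : Permutation′ n) i → inverted π i i ≡ 0
inverted-diag π i = cong (_* χ< (π ⟨$⟩ʳ i) (π ⟨$⟩ʳ i)) (χ<-irrefl i)

inverted-punchIn : ∀ {n} (π : Permutation′ (suc n)) x i j →
                   inverted π (punchIn x i) (punchIn x j) ≡ inverted (remove x π) i j
inverted-punchIn π x i j = cong₂ _*_ (χ<-punchIn x i j) (begin
    χ< (π ⟨$⟩ʳ punchIn x j) (π ⟨$⟩ʳ punchIn x i)
  ≡⟨ cong₂ χ< (Perm.punchIn-permute π x j) (Perm.punchIn-permute π x i) ⟩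
    χ< (punchIn (π ⟨$⟩ʳ x) (remove x π ⟨$⟩ʳ j)) (punchIn (π ⟨$⟩ʳ x) (remove x π ⟨$⟩ʳ i))
  ≡⟨ χ<-punchIn (π ⟨$⟩ʳ x) _ _ ⟩
    χ< (remove x π ⟨$⟩ʳ j) (remove x π ⟨$⟩ʳ i)
  ∎)

crossings : ∀ {n} → Permutation′ n → Fin n → ℕ
crossings {n} π x = ∑[ i < n ] inverted π i x + ∑[ j < n ] inverted π x j

inversions-remove : ∀ {n} (π : Permutation′ (suc n)) x →
                    inversions π ≡ inversions (remove x π) + crossings π x
inversions-remove {n} π x = begin
    ∑[ i < suc n ] row i
  ≡⟨ sum-remove {i = x} row ⟩
    row x + ∑[ i < n ] row (punchIn x i)
  ≡⟨ cong (_+_ (row x)) (sum-cong-≗ {n} λ i → sum-remove {i = x} (inverted π (punchIn x i))) ⟩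
    row x + ∑[ i < n ] (inverted π (punchIn x i) x + ∑[ j < n ] inverted π (punchIn x i) (punchIn x j))
  ≡⟨ cong (_+_ (row x)) (∑-distrib-+ {n} _ _) ⟩
    row x + (column + ∑[ i < n ] ∑[ j < n ] inverted π (punchIn x i) (punchIn x j))
  ≡⟨ cong (λ s → row x + (column + s)) (sum-cong-≗ {n} λ i → sum-cong-≗ {n} λ j → inverted-punchIn π x i j) ⟩
    row x + (column + inversions (remove x π))
  ≡⟨ regroup (row x) column (inversions (remove x π)) ⟩
    inversions (remove x π) + ((0 + column) + row x)
  ≡⟨ cong (λ c → inversions (remove x π) + ((c + column) + row x)) (inverted-diag π x) ⟨
    inversions (remove x π) + ((inverted π x x + column) + row x)
  ≡⟨ cong (λ c → inversions (remove x π) + (c + row x)) (sum-remove {i = x} (λ i → inverted π i x)) ⟨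
    inversions (remove x π) + crossings π x
  ∎
  where
  row : Fin (suc n) → ℕ
  row i = ∑[ j < suc n ] inverted π i j
  column = ∑[ i < n ] inverted π (punchIn x i) x
  regroup : ∀ r c s → r + (c + s) ≡ s + ((0 + c) + r)
  regroup = solve-∀

∑-crossings : ∀ {n} (π : Permutation′ n) → ∑[ x < n ] crossings π x ≡ inversions π + inversions π
∑-crossings {n} π = begin
    ∑[ x < n ] (∑[ i < n ] inverted π i x + ∑[ j < n ] inverted π x j)
  ≡⟨ ∑-distrib-+ {n} _ _ ⟩
    ∑[ x < n ] ∑[ i < n ] inverted π i x + inversions π
  ≡⟨ cong (_+ inversions π) (∑-comm {n} {n} λ x i → inverted π i x) ⟩
    inversions π + inversions π
  ∎

crossings-zero : ∀ {n} (π : Permutation′ (suc n)) → crossings π zero ≡ toℕ (π ⟨$⟩ʳ zero)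
crossings-zero {n} π = begin
    ∑[ i < suc n ] (χ< i zero * χ< (π ⟨$⟩ʳ zero) (π ⟨$⟩ʳ i)) + ∑[ j < suc n ] inverted π zero j
  ≡⟨ cong₂ _+_ (sum-cong-≗ {suc n} λ i → cong (_* χ< (π ⟨$⟩ʳ zero) (π ⟨$⟩ʳ i)) (χ<-zeroʳ i))
               (sum-cong-≗ {suc n} below-π₀) ⟩
    ∑[ i < suc n ] 0 + ∑[ j < suc n ] χ< (π ⟨$⟩ʳ j) (π ⟨$⟩ʳ zero)
  ≡⟨ cong₂ _+_ (sum-replicate-zero (suc n)) (sym (∑-permute (λ v → χ< v (π ⟨$⟩ʳ zero)) π)) ⟩
    0 + ∑[ v < suc n ] χ< v (π ⟨$⟩ʳ zero)
  ≡⟨ ∑-χ< (suc n) (π ⟨$⟩ʳ zero) ⟩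
    toℕ (π ⟨$⟩ʳ zero)
  ∎
  where
  below-π₀ : ∀ j → inverted π zero j ≡ χ< (π ⟨$⟩ʳ j) (π ⟨$⟩ʳ zero)
  below-π₀ zero    = sym (χ<-irrefl (π ⟨$⟩ʳ zero))
  below-π₀ (suc j) = ℕ.+-identityʳ _

crossings-onto-zero : ∀ {n} (π : Permutation′ (suc n)) {x} → π ⟨$⟩ʳ x ≡ zero → crossings π x ≡ toℕ x
crossings-onto-zero {n} π {x} πx≡0 = begin
    ∑[ i < suc n ] inverted π i x + ∑[ j < suc n ] (χ< x j * χ< (π ⟨$⟩ʳ j) (π ⟨$⟩ʳ x))
  ≡⟨ cong₂ _+_ (sum-cong-≗ {suc n} before-x)
               (sum-cong-≗ {suc n} λ j → cong (λ v → χ< x j * χ< (π ⟨$⟩ʳ j) v) πx≡0) ⟩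
    ∑[ i < suc n ] χ< i x + ∑[ j < suc n ] (χ< x j * χ< (π ⟨$⟩ʳ j) zero)
  ≡⟨ cong₂ _+_ (∑-χ< (suc n) x)
               (sum-cong-≗ {suc n} λ j → trans (cong (χ< x j *_) (χ<-zeroʳ (π ⟨$⟩ʳ j))) (ℕ.*-zeroʳ (χ< x j))) ⟩
    toℕ x + ∑[ j < suc n ] 0
  ≡⟨ trans (cong (_+_ (toℕ x)) (sum-replicate-zero (suc n))) (ℕ.+-identityʳ (toℕ x)) ⟩
    toℕ x
  ∎
  where
  before-x : ∀ i → inverted π i x ≡ χ< i x
  before-x i with i Fin.≟ x
  ... | yes refl = trans (inverted-diag π x) (sym (χ<-irrefl x))
  ... | no  i≢x  = begin
      χ< i x * χ< (π ⟨$⟩ʳ x) (π ⟨$⟩ʳ i)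
    ≡⟨ cong (λ v → χ< i x * χ< v (π ⟨$⟩ʳ i)) πx≡0 ⟩
      χ< i x * χ< zero (π ⟨$⟩ʳ i)
    ≡⟨ cong (χ< i x *_) (χ<-zeroˡ λ πi≡0 → i≢x (Injection.injective (↔⇒↣ π) (trans πi≡0 (sym πx≡0)))) ⟩
      χ< i x * 1
    ≡⟨ ℕ.*-identityʳ (χ< i x) ⟩
      χ< i x
    ∎

-- In cycle notation, the step x ↦ σ x of σ becomes x + 1 ↦ 0 ↦ σ x + 1 (old points are shifted up by one).
insertAfter : ∀ {m} → Permutation′ m → Fin m → Permutation′ (suc m)
insertAfter σ x = transpose zero (suc x) ∘ₚ lift₀ σ

insertAfter-at : ∀ {m} (σ : Permutation′ m) x → insertAfter σ x ⟨$⟩ʳ suc x ≡ zero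
insertAfter-at σ x rewrite dec-true (x Fin.≟ x) refl = refl

insertAfter-other : ∀ {m} (σ : Permutation′ m) {x i} → i ≢ x → insertAfter σ x ⟨$⟩ʳ suc i ≡ suc (σ ⟨$⟩ʳ i)
insertAfter-other σ {x} {i} i≢x rewrite dec-false (i Fin.≟ x) i≢x = refl

insertAfter-cong : ∀ {m} {σ σ′ : Permutation′ m} x →
                   SamePerm σ σ′ → SamePerm (insertAfter σ x) (insertAfter σ′ x)
insertAfter-cong {σ = σ} {σ′} x σ≈σ′ k = Perm.lift₀-cong σ σ′ σ≈σ′ (PC.transpose zero (suc x) k)

insertAfter-injective : ∀ {m} {σ σ′ : Permutation′ m} {x y} →
                        SamePerm (insertAfter σ x) (insertAfter σ′ y) → x ≡ y × SamePerm σ σ′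
insertAfter-injective {σ = σ} {σ′} {x} {y} eq with x Fin.≟ y
... | no x≢y   = contradiction (trans (sym (insertAfter-at σ x)) (trans (eq (suc x)) (insertAfter-other σ′ x≢y))) λ ()
... | yes refl = refl , σ≈σ′
  where
  σ≈σ′ : SamePerm σ σ′
  σ≈σ′ i with i Fin.≟ x
  ... | yes refl = Fin.suc-injective (eq zero)
  ... | no  i≢x  = Fin.suc-injective
    (trans (sym (insertAfter-other σ i≢x)) (trans (eq (suc i)) (insertAfter-other σ′ i≢x)))

insertAfter-derangement : ∀ {m} (σ : Permutation′ (suc m)) x →
                          (∀ i → i ≢ x → σ ⟨$⟩ʳ i ≢ i) → Derangement (insertAfter σ x)
insertAfter-derangement σ x σ-fixes-only-x zero    ()
insertAfter-derangement σ x σ-fixes-only-x (suc i) = ∀-punchIn (λ i → insertAfter σ x ⟨$⟩ʳ suc i ≢ suc i) x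
  (λ eq → contradiction (trans (sym (insertAfter-at σ x)) eq) λ ())
  (λ j eq → σ-fixes-only-x (punchIn x j) (Fin.punchInᵢ≢i x j)
              (Fin.suc-injective (trans (sym (insertAfter-other σ (Fin.punchInᵢ≢i x j))) eq)))
  i

inversions-insertAfter : ∀ {m} (σ : Permutation′ (suc m)) x →
  inversions (insertAfter σ x) ≡ suc (toℕ (σ ⟨$⟩ʳ x) + toℕ x) + inversions (remove x σ)
inversions-insertAfter σ x = begin
    inversions π
  ≡⟨ inversions-remove π zero ⟩
    inversions ρ + crossings π zero
  ≡⟨ cong₂ _+_ (inversions-remove ρ x) (crossings-zero π) ⟩
    inversions (remove x ρ) + crossings ρ x + suc (toℕ (σ ⟨$⟩ʳ x))
  ≡⟨ cong₂ (λ r c → r + c + suc (toℕ (σ ⟨$⟩ʳ x)))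
            (inversions-cong {π = remove x ρ} {remove x σ} remove-x-ρ) (crossings-onto-zero ρ {x} ρx≡0) ⟩
    inversions (remove x σ) + toℕ x + suc (toℕ (σ ⟨$⟩ʳ x))
  ≡⟨ regroup (inversions (remove x σ)) (toℕ x) (toℕ (σ ⟨$⟩ʳ x)) ⟩
    suc (toℕ (σ ⟨$⟩ʳ x) + toℕ x) + inversions (remove x σ)
  ∎
  where
  π = insertAfter σ x
  ρ = remove zero π
  ρx≡0 : ρ ⟨$⟩ʳ x ≡ zero
  ρx≡0 = remove-⟨$⟩ʳ π zero (insertAfter-at σ x)
  ρ-punchIn : ∀ k → ρ ⟨$⟩ʳ punchIn x k ≡ suc (remove x σ ⟨$⟩ʳ k)
  ρ-punchIn k = remove-⟨$⟩ʳ π zero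
    (trans (insertAfter-other σ (Fin.punchInᵢ≢i x k)) (cong suc (Perm.punchIn-permute σ x k)))
  remove-x-ρ : SamePerm (remove x ρ) (remove x σ)
  remove-x-ρ k = remove-⟨$⟩ʳ ρ x (trans (ρ-punchIn k) (cong (λ z → punchIn z (remove x σ ⟨$⟩ʳ k)) (sym ρx≡0)))
  regroup : ∀ r x s → r + x + suc s ≡ suc (s + x) + r
  regroup = solve-∀

∑-inversions-insertAfter : ∀ {m} (σ : Permutation′ (suc m)) →
  ∑[ x < suc m ] inversions (insertAfter σ x) + 2 * inversions σ ≡ suc m * suc m + suc m * inversions σ
∑-inversions-insertAfter {m} σ = begin
    ∑[ x < suc m ] inversions (insertAfter σ x) + 2 * inversions σ
  ≡⟨ cong (_+ 2 * inversions σ)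
         (trans (sum-cong-≗ {suc m} (inversions-insertAfter σ)) (∑-distrib-+ {suc m} shift removed)) ⟩
    ∑[ x < suc m ] shift x + ∑[ x < suc m ] removed x + 2 * inversions σ
  ≡⟨ regroup (∑[ x < suc m ] shift x) (∑[ x < suc m ] removed x) (inversions σ) ⟩
    ∑[ x < suc m ] shift x + (∑[ x < suc m ] removed x + (inversions σ + inversions σ))
  ≡⟨ cong₂ _+_ (∑-suc[σ+id] σ) (cong (_+_ (∑[ x < suc m ] removed x)) (sym (∑-crossings σ))) ⟩
    suc m * suc m + (∑[ x < suc m ] removed x + ∑[ x < suc m ] crossings σ x)
  ≡⟨ cong (_+_ (suc m * suc m)) (∑-distrib-+ {suc m} removed (crossings σ)) ⟨
    suc m * suc m + ∑[ x < suc m ] (removed x + crossings σ x)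
  ≡⟨ cong (_+_ (suc m * suc m))
         (trans (sum-cong-≗ {suc m} (sym ∘ inversions-remove σ)) (∑-const (suc m) (inversions σ))) ⟩
    suc m * suc m + suc m * inversions σ
  ∎
  where
  shift removed : Fin (suc m) → ℕ
  shift x = suc (toℕ (σ ⟨$⟩ʳ x) + toℕ x)
  removed x = inversions (remove x σ)
  regroup : ∀ a b i → a + b + 2 * i ≡ a + (b + (i + i))
  regroup = solve-∀

bypassZero : ∀ {m} → Permutation′ (suc m) → Fin m → Permutation′ m
bypassZero π x = remove zero (transpose (suc x) zero ∘ₚ π)

insertAfter-bypassZero : ∀ {m} (π : Permutation′ (suc m)) {x} → π ⟨$⟩ʳ suc x ≡ zero →
                         SamePerm (insertAfter (bypassZero π x) x) π
insertAfter-bypassZero π {x} πx≡0 k = trans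
  (Perm.lift₀-remove (transpose (suc x) zero ∘ₚ π) πx≡0 (PC.transpose zero (suc x) k))
  (cong (π ⟨$⟩ʳ_) (PC.transpose-inverse (suc x) zero))

-- insert x x τ fixes x, and insertAfter turns that fixed point into the 2-cycle (0 x + 1).
withTwoCycle : ∀ {n} → Permutation′ n → Fin (suc n) → Permutation′ (suc (suc n))
withTwoCycle τ x = insertAfter (insert x x τ) x

withTwoCycle-injective : ∀ {n} {τ τ′ : Permutation′ n} {x y} →
                         SamePerm (withTwoCycle τ x) (withTwoCycle τ′ y) → x ≡ y × SamePerm τ τ′
withTwoCycle-injective {x = x} eq with insertAfter-injective eq
... | refl , ins≈ins = refl , insert-injective x x ins≈ins

∑-inversions-withTwoCycle : ∀ {n} (τ : Permutation′ n) →
  ∑[ x < suc n ] inversions (withTwoCycle τ x) ≡ suc n * suc n + suc n * inversions τ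
∑-inversions-withTwoCycle {n} τ = begin
    ∑[ x < suc n ] inversions (withTwoCycle τ x)
  ≡⟨ sum-cong-≗ {suc n} inversions-withTwoCycle ⟩
    ∑[ x < suc n ] (suc (toℕ x + toℕ x) + inversions τ)
  ≡⟨ ∑-distrib-+ {suc n} (λ x → suc (toℕ x + toℕ x)) (λ _ → inversions τ) ⟩
    ∑[ x < suc n ] suc (toℕ x + toℕ x) + ∑[ x < suc n ] inversions τ
  ≡⟨ cong₂ _+_ (∑-odd (suc n)) (∑-const (suc n) (inversions τ)) ⟩
    suc n * suc n + suc n * inversions τ
  ∎
  where
  inversions-withTwoCycle : ∀ x → inversions (withTwoCycle τ x) ≡ suc (toℕ x + toℕ x) + inversions τ
  inversions-withTwoCycle x = trans (inversions-insertAfter (insert x x τ) x)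
    (cong₂ (λ v r → suc (toℕ v + toℕ x) + r) (insert-at x x τ)
           (inversions-cong {π = remove x (insert x x τ)} {τ} (Perm.remove-insert x x τ)))

-- The list of derangements

grafts : ∀ {n} → List (Permutation′ (suc n)) → List (Permutation′ (suc (suc n)))
grafts = concatMap (tabulate ∘ insertAfter)

twoCycles : ∀ {n} → List (Permutation′ n) → List (Permutation′ (suc (suc n)))
twoCycles = concatMap (tabulate ∘ withTwoCycle)

derangements : (n : ℕ) → List (Permutation′ n)
derangements zero          = [ Perm.id ]
derangements (suc zero)    = []
derangements (suc (suc n)) = grafts (derangements (suc n)) ++ twoCycles (derangements n)

derangements-sound : ∀ n → All Derangement (derangements n)
derangements-sound zero          = (λ ()) ∷ []
derangements-sound (suc zero)    = []
derangements-sound (suc (suc n)) = All.++⁺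
  (All-concatMap-tabulate insertAfter (λ σ-der x → insertAfter-derangement _ x (λ i _ → σ-der i))
    (derangements-sound (suc n)))
  (All-concatMap-tabulate withTwoCycle (λ τ-der x → insertAfter-derangement _ x (insert-derangement x _ τ-der))
    (derangements-sound n))

derangements-distinct : ∀ n → AllPairs (λ π σ → ¬ SamePerm π σ) (derangements n)
derangements-distinct zero          = [] ∷ []
derangements-distinct (suc zero)    = []
derangements-distinct (suc (suc n)) = AllPairs.++⁺
  (AllPairs-concatMap-tabulate insertAfter
    (λ _ x≢y eq → x≢y (proj₁ (insertAfter-injective eq)))
    (λ σ≉σ′ _ _ eq → σ≉σ′ (proj₂ (insertAfter-injective eq)))
    (derangements-distinct (suc n)))
  (AllPairs-concatMap-tabulate withTwoCycle
    (λ _ x≢y eq → x≢y (proj₁ (withTwoCycle-injective eq)))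
    (λ τ≉τ′ _ _ eq → τ≉τ′ (proj₂ (withTwoCycle-injective eq)))
    (derangements-distinct n))
  (All-concatMap-tabulate insertAfter (λ σ-der x →
    All-concatMap-tabulate withTwoCycle (λ {τ} _ y → no-two-cycle {τ = τ} σ-der x y)
      (All.universal (λ _ → tt) (derangements n)))
    (derangements-sound (suc n)))
  where
  no-two-cycle : ∀ {σ : Permutation′ (suc n)} {τ : Permutation′ n} →
                 Derangement σ → ∀ x y → ¬ SamePerm (insertAfter σ x) (withTwoCycle τ y)
  no-two-cycle {τ = τ} σ-der x y eq with insertAfter-injective eq
  ... | refl , σ≈ins = σ-der x (trans (σ≈ins x) (insert-at x x τ))

Complete : ∀ n → List (Permutation′ n) → Set
Complete n ds = ∀ π → Derangement π → Any (λ π′ → SamePerm π′ π) ds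

derangements-complete-step : ∀ {n} → Complete (suc n) (derangements (suc n)) → Complete n (derangements n) →
                             Complete (suc (suc n)) (derangements (suc (suc n)))
derangements-complete-step {n} complete₁ complete₀ π π-der with π Perm.⟨$⟩ˡ zero | Perm.inverseʳ π {zero}
... | zero  | π0≡0 = contradiction π0≡0 (π-der zero)
... | suc x | πx≡0 = split (σ ⟨$⟩ʳ x Fin.≟ x)
  where
  σ = bypassZero π x
  π≈ : SamePerm (insertAfter σ x) π
  π≈ = insertAfter-bypassZero π πx≡0
  σ-fixes-only-x : ∀ i → i ≢ x → σ ⟨$⟩ʳ i ≢ i
  σ-fixes-only-x i i≢x σi≡i =
    π-der (suc i) (trans (sym (π≈ (suc i))) (trans (insertAfter-other σ i≢x) (cong suc σi≡i)))
  split : Dec (σ ⟨$⟩ʳ x ≡ x) → Any (λ π′ → SamePerm π′ π) (derangements (suc (suc n)))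
  split (no σx≢x) = Any.++⁺ˡ
    (Any-concatMap-tabulate insertAfter x (λ σ′≈σ k → trans (insertAfter-cong x σ′≈σ k) (π≈ k))
      (complete₁ σ σ-der))
    where
    σ-der : Derangement σ
    σ-der = ∀-punchIn (λ i → σ ⟨$⟩ʳ i ≢ i) x σx≢x (λ j → σ-fixes-only-x (punchIn x j) (Fin.punchInᵢ≢i x j))
  split (yes σx≡x) = Any.++⁺ʳ (grafts (derangements (suc n)))
    (Any-concatMap-tabulate withTwoCycle x
      (λ τ′≈τ k → trans (insertAfter-cong x (λ i → trans (insert-cong x x τ′≈τ i) (insert-remove i)) k) (π≈ k))
      (complete₀ τ τ-der))
    where
    τ = remove x σ
    τ-der : Derangement τ
    τ-der j τj≡j = σ-fixes-only-x (punchIn x j) (Fin.punchInᵢ≢i x j)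
      (trans (Perm.punchIn-permute σ x j) (cong₂ punchIn σx≡x τj≡j))
    insert-remove : SamePerm (insert x x τ) σ
    insert-remove k = trans (cong (λ v → insert x v τ ⟨$⟩ʳ k) (sym σx≡x)) (Perm.insert-remove x σ k)

derangements-complete : ∀ n → Complete n (derangements n)
derangements-complete zero          π _     = here (λ ())
derangements-complete (suc zero)    π π-der with π ⟨$⟩ʳ zero | π-der zero
... | zero | π0≢0 = contradiction refl π0≢0
derangements-complete (suc (suc n)) = derangements-complete-step (derangements-complete (suc n)) (derangements-complete n)

-- Counting

D T : ℕ → ℕ
D n = length (derangements n)
T n = sum (map inversions (derangements n))

D-rec : ∀ n → D (suc (suc n)) ≡ suc n * (D (suc n) + D n)
D-rec n = begin
    length (grafts (derangements (suc n)) ++ twoCycles (derangements n))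
  ≡⟨ List.length-++ (grafts (derangements (suc n))) ⟩
    length (grafts (derangements (suc n))) + length (twoCycles (derangements n))
  ≡⟨ cong₂ _+_ (length-concatMap-tabulate insertAfter (derangements (suc n)))
               (length-concatMap-tabulate withTwoCycle (derangements n)) ⟩
    suc n * D (suc n) + suc n * D n
  ≡⟨ ℕ.*-distribˡ-+ (suc n) (D (suc n)) (D n) ⟨
    suc n * (D (suc n) + D n)
  ∎

sum-inversions-grafts : ∀ {n} (σs : List (Permutation′ (suc n))) →
  sum (map inversions (grafts σs)) + 2 * sum (map inversions σs)
    ≡ suc n * suc n * length σs + suc n * sum (map inversions σs)
sum-inversions-grafts {n} σs = trans
  (cong (_+ 2 * sum (map inversions σs)) (sum-map-concatMap-tabulate insertAfter inversions σs))
  (sum-map-linear (λ σ → ∑[ x < suc n ] inversions (insertAfter σ x)) inversions {2} {suc n * suc n} {suc n}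
    ∑-inversions-insertAfter σs)

sum-inversions-twoCycles : ∀ {n} (τs : List (Permutation′ n)) →
  sum (map inversions (twoCycles τs)) ≡ suc n * suc n * length τs + suc n * sum (map inversions τs)
sum-inversions-twoCycles {n} τs = begin
    sum (map inversions (twoCycles τs))
  ≡⟨ sum-map-concatMap-tabulate withTwoCycle inversions τs ⟩
    sum (map twoCycleSum τs)
  ≡⟨ ℕ.+-identityʳ (sum (map twoCycleSum τs)) ⟨
    sum (map twoCycleSum τs) + 0 * sum (map inversions τs)
  ≡⟨ sum-map-linear twoCycleSum inversions {0} {suc n * suc n} {suc n}
       (λ τ → trans (ℕ.+-identityʳ (twoCycleSum τ)) (∑-inversions-withTwoCycle τ)) τs ⟩
    suc n * suc n * length τs + suc n * sum (map inversions τs)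
  ∎
  where
  twoCycleSum : Permutation′ n → ℕ
  twoCycleSum τ = ∑[ x < suc n ] inversions (withTwoCycle τ x)

T-rec : ∀ n → T (suc (suc n)) + 2 * T (suc n) ≡ suc n * (D (suc (suc n)) + T (suc n) + T n)
T-rec n = begin
    sum (map inversions (gs ++ cs)) + 2 * T (suc n)
  ≡⟨ cong (_+ 2 * T (suc n)) (trans (cong sum (List.map-++ inversions gs cs)) (sum-++ (map inversions gs) _)) ⟩
    sum (map inversions gs) + sum (map inversions cs) + 2 * T (suc n)
  ≡⟨ regroup (sum (map inversions gs)) (sum (map inversions cs)) (T (suc n)) ⟩
    (sum (map inversions gs) + 2 * T (suc n)) + sum (map inversions cs)
  ≡⟨ cong₂ _+_ (sum-inversions-grafts (derangements (suc n))) (sum-inversions-twoCycles (derangements n)) ⟩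
    (suc n * suc n * D (suc n) + suc n * T (suc n)) + (suc n * suc n * D n + suc n * T n)
  ≡⟨ factor (suc n) (D (suc n)) (D n) (T (suc n)) (T n) ⟩
    suc n * (suc n * (D (suc n) + D n) + T (suc n) + T n)
  ≡⟨ cong (λ d → suc n * (d + T (suc n) + T n)) (D-rec n) ⟨
    suc n * (D (suc (suc n)) + T (suc n) + T n)
  ∎
  where
  gs = grafts (derangements (suc n))
  cs = twoCycles (derangements n)
  regroup : ∀ a b t → a + b + 2 * t ≡ (a + 2 * t) + b
  regroup = solve-∀
  factor : ∀ m d₁ d₀ t₁ t₀ → (m * m * d₁ + m * t₁) + (m * m * d₀ + m * t₀) ≡ m * (m * (d₁ + d₀) + t₁ + t₀)
  factor = solve-∀

permutationSetoid : ℕ → Setoid 0ℓ 0ℓ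
permutationSetoid n = On.setoid {B = Permutation′ n} (Fin n →-setoid Fin n) (_⟨$⟩ʳ_)

totalInv≡T : ∀ n ds → EnumeratesDerangements n ds → totalInv ds ≡ T n
totalInv≡T n ds enum = begin
    sum (map inv ds)
  ≡⟨ cong sum (List.map-cong inv≡inversions ds) ⟩
    sum (map inversions ds)
  ≡⟨ unique-cover⇒sum-map-≡ (permutationSetoid n) inversions (λ {π} {σ} → inversions-cong {π = π} {σ})
       distinct (derangements-distinct n)
       (All.map (λ {π} → derangements-complete n π) sound) (All.map (λ {π} → complete π) (derangements-sound n)) ⟩
    T n
  ∎
  where open EnumeratesDerangements enum

theorem4p1 : (n : ℕ) →
    Σ (List (Permutation′ n)) (EnumeratesDerangements n)
    × ((ds : List (Permutation′ n)) → EnumeratesDerangements n ds →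
        (+ totalInv ds) / 1 ≡ rhs n)
theorem4p1 n = (derangements n , derangements-enumerate) , λ ds enum → begin
    + totalInv ds / 1  ≡⟨ cong (λ t → + t / 1) (totalInv≡T n ds enum) ⟩
    + T n / 1          ≡⟨ ClosedForm.rhs≡t D T refl refl refl refl D-rec T-rec n ⟨
    rhs n              ∎
  where
  derangements-enumerate : EnumeratesDerangements n (derangements n)
  derangements-enumerate = record
    { sound    = derangements-sound n
    ; complete = derangements-complete n
    ; distinct = derangements-distinct n
    }
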